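{- Let $U\subseteq\mathcal{B}$ be maximal avoidable and suppose $U$ contains an element $(a,0)$ with $a\ge 1$. Then there is an odd integer $d<a$ such that $U=\{(a,0),(0,0)\}\cup\{(c,d)\in\mathcal{B}\mid \max\{c,c+d\}<a\}$.
   Context: The bicyclic inverse semigroup is $\mathcal{B}=\{(a,b)\in\mathbb{Z}\times\mathbb{Z}\mid a\ge 0,\ a+b\ge 0\}$ with multiplication $(a,b)(c,d)=(\max\{c+d,a\}-d,\ b+d)$. A subset $U\subseteq\mathcal{B}$ is avoidable if $\mathcal{B}$ can be partitioned into two sets $A$ and $B$ such that no element of $U$ is a product $st$ of two distinct elements $s\ne t$ both in $A$ or both in $B$. $U$ is maximal avoidable if it is avoidable and not properly contained in any avoidable subset of $\mathcal{B}$. -}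

module Defs where

open import Data.Integer using (ℤ; +_; _+_; _-_; _*_; _≤_; _<_; _⊔_)
open import Data.Bool using (Bool)
open import Data.Product using (Σ; ∃; _×_; _,_)
open import Data.Sum using (_⊎_)
open import Relation.Binary.PropositionalEquality using (_≡_)
open import Relation.Nullary using (¬_)
open import Function.Bundles using (_⇔_)
open import Level using (0ℓ)

-- elements of the bicyclic inverse semigroup: (a , b) with a ≥ 0, a + b ≥ 0
record 𝓑 : Set where
  constructor ⟨_,_∣_,_⟩
  field
    fst : ℤ
    snd : ℤ
    fst≥0 : + 0 ≤ fst
    sum≥0 : + 0 ≤ fst + snd
open 𝓑 public

In𝓑 : ℤ → ℤ → Set
In𝓑 a b = (+ 0 ≤ a) × (+ 0 ≤ a + b)

_≈_ : 𝓑 → 𝓑 → Set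
x ≈ y = (fst x ≡ fst y) × (snd x ≡ snd y)

_is⟨_,_⟩ : 𝓑 → ℤ → ℤ → Set
x is⟨ a , b ⟩ = (fst x ≡ a) × (snd x ≡ b)

mulFst mulSnd : 𝓑 → 𝓑 → ℤ
mulFst s t = ((fst t + snd t) ⊔ fst s) - snd t
mulSnd s t = snd s + snd t

Subset : Set₁
Subset = 𝓑 → Set

_⊆_ : Subset → Subset → Set
U ⊆ V = ∀ x → U x → V x

-- U is closed under ≈ is automatic for predicates on pairs; we require
-- products to be recognised via their pair: x ∈ U with x ≈ s·t.
-- A two-colouring χ encodes the partition 𝓑 = A ⊔ B (A = χ⁻¹ true).
Avoidable : Subset → Set
Avoidable U = Σ (𝓑 → Bool) λ χ →
  ∀ (s t : 𝓑) → ¬ (s ≈ t) → χ s ≡ χ t →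
  ∀ (u : 𝓑) → U u → ¬ (u is⟨ mulFst s t , mulSnd s t ⟩)

MaximalAvoidable : Subset → Set₁
MaximalAvoidable U = Avoidable U × (∀ (V : Subset) → U ⊆ V → Avoidable V → V ⊆ U)

OddInt : ℤ → Set
OddInt d = Σ ℤ λ k → d ≡ + 2 * k + + 1

module Submission where

-- Fix a colouring χ avoiding U, and write A = (a,0), O = (0,0).  Distinct factors of an
-- element of U get different colours, and factorisations of A alone already force a rigid
-- pattern: every small element x (fst x < a or fst x + snd x < a) has the colour col (snd x)
-- of its row, and opposite rows h ≠ 0, -h have opposite colours.  Factoring a box element
-- w = (c, p + q) of U as (c+q, p)(c, q) gives col p ≠ col q.  Hence U consists of A, O and
-- box elements with odd second coordinate, all of them in one row d.  Conversely χ avoids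
-- S d = {A, O} ∪ {(c,d) in the box}, so maximality gives U = S d.
--
-- U is an arbitrary predicate, so d cannot be read off U constructively; it is found by a
-- finite search over the colouring instead, and the existence of a box element of U is only
-- used under double negation (it follows from the avoidable set {A, O, (0,1)}).

open import Defs
open import Data.Integer
  using (ℤ; +_; -[1+_]; _+_; _-_; -_; _*_; _<_; _≤_; _⊔_; ∣_∣; +≤+; +<+; -<+)
open import Data.Integer.Properties
open import Data.Integer.Tactic.RingSolver using (solve-∀)
open import Data.Integer.DivMod using (_%ℕ_; _/ℕ_; n%ℕd<d; a≡a%ℕn+[a/ℕn]*n)
open import Data.Nat using (ℕ; zero; suc; z≤n; s≤s; anyUpTo?; allUpTo?)
import Data.Nat as ℕ
import Data.Nat.Properties as ℕₚ
open import Data.Bool using (Bool; true; false; not)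
open import Data.Bool.Properties using (¬-not; not-injective) renaming (_≟_ to _≟ᵇ_)
open import Data.Product using (Σ; ∃; _×_; _,_; proj₁; proj₂)
open import Data.Sum using (_⊎_; inj₁; inj₂; [_,_]′)
open import Data.Empty using (⊥; ⊥-elim)
open import Function using (_∘_; id)
open import Function.Bundles using (_⇔_; mk⇔)
open import Relation.Nullary using (¬_; Dec; yes; no; does)
open import Relation.Nullary.Decidable using (map′; _×-dec_; ¬?; dec-true)
open import Relation.Unary using (Decidable)
open import Relation.Binary.PropositionalEquality

-- Linear inequalities are proved by certificate: i ≤ j holds once the ring solver identifies
-- j - i with a sum of terms already known to be non-negative.
NonNeg : ℤ → Set
NonNeg x = + 0 ≤ x

nonNeg-+ : ∀ {x y} → NonNeg x → NonNeg y → NonNeg (x + y)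
nonNeg-+ = +-mono-≤

nonNeg-ℕ : ∀ m → NonNeg (+ m)
nonNeg-ℕ m = +≤+ z≤n

halve : ∀ {x} → NonNeg (x + x) → NonNeg x
halve {+ m} _ = nonNeg-ℕ m
halve { -[1+ m ]} ()

private
  suc-gap : ∀ j i → j - (+ 1 + i) ≡ j - i - + 1
  suc-gap = solve-∀

gap-≤ : ∀ {i j} → i ≤ j → NonNeg (j - i)
gap-≤ = i≤j⇒0≤j-i

gap-< : ∀ {i j} → i < j → NonNeg (j - i - + 1)
gap-< {i} {j} i<j = subst NonNeg (suc-gap j i) (gap-≤ (i<j⇒suc[i]≤j i<j))

≤-by : ∀ {i j n} → NonNeg n → j - i ≡ n → i ≤ j
≤-by 0≤n gap = 0≤i-j⇒j≤i (subst NonNeg (sym gap) 0≤n)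

<-by : ∀ {i j n} → NonNeg n → j - i - + 1 ≡ n → i < j
<-by {i} {j} 0≤n gap = suc[i]≤j⇒i<j (≤-by 0≤n (trans (suc-gap j i) gap))

both-differ : ∀ {x y z : Bool} → x ≢ z → y ≢ z → x ≡ y
both-differ x≢z y≢z = trans (¬-not x≢z) (sym (¬-not y≢z))

no-three-colours : ∀ {x y z : Bool} → x ≢ y → y ≢ z → x ≢ z → ⊥
no-three-colours x≢y y≢z x≢z = x≢z (both-differ x≢y (≢-sym y≢z))

even-or-odd : ∀ e → (Σ ℤ λ k → e ≡ k + k) ⊎ OddInt e
even-or-odd e with e %ℕ 2 | n%ℕd<d e 2 | a≡a%ℕn+[a/ℕn]*n e 2
... | 0           | _            | e≡ = inj₁ (e /ℕ 2 , trans e≡ (twice (e /ℕ 2)))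
  where twice : ∀ k → + 0 + k * + 2 ≡ k + k
        twice = solve-∀
... | 1           | _            | e≡ = inj₂ (e /ℕ 2 , trans e≡ (twice+1 (e /ℕ 2)))
  where twice+1 : ∀ k → + 1 + k * + 2 ≡ + 2 * k + + 1
        twice+1 = solve-∀
... | suc (suc _) | s≤s (s≤s ()) | _

odd≢0 : ∀ {d} → OddInt d → d ≢ + 0
odd≢0 (j , refl) with + 0 ≤? j
... | yes 0≤j = λ d≡0 → <⇒≢ (<-by (nonNeg-+ 0≤j 0≤j) (positive j)) (sym d≡0)
  where positive : ∀ j → + 2 * j + + 1 - + 0 - + 1 ≡ j + j
        positive = solve-∀
... | no  j≱0 = <⇒≢ (<-by (nonNeg-+ (gap-< j<0) (gap-< j<0)) (negative j))
  where j<0 = ≰⇒> j≱0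
        negative : ∀ j → + 0 - (+ 2 * j + + 1) - + 1 ≡ (+ 0 - j - + 1) + (+ 0 - j - + 1)
        negative = solve-∀

_≐_·_ : 𝓑 → 𝓑 → 𝓑 → Set
u ≐ s · t = u is⟨ mulFst s t , mulSnd s t ⟩

Avoids : (𝓑 → Bool) → Subset → Set
Avoids χ U = ∀ (s t : 𝓑) → ¬ (s ≈ t) → χ s ≡ χ t → ∀ (u : 𝓑) → U u → ¬ (u ≐ s · t)

mulFst-right : ∀ s t → fst s ≤ fst t + snd t → mulFst s t ≡ fst t
mulFst-right s t s≤t = begin
  ((fst t + snd t) ⊔ fst s) - snd t  ≡⟨ cong (_- snd t) (i≥j⇒i⊔j≡i s≤t) ⟩
  (fst t + snd t) - snd t            ≡⟨ cancel (fst t) (snd t) ⟩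
  fst t                              ∎
  where
  open ≡-Reasoning
  cancel : ∀ x y → (x + y) - y ≡ x
  cancel = solve-∀

mulFst-left : ∀ s t → fst t + snd t ≤ fst s → mulFst s t ≡ fst s - snd t
mulFst-left s t t≤s = cong (_- snd t) (i≤j⇒i⊔j≡j t≤s)

fst-right≤ : ∀ s t → fst t ≤ mulFst s t
fst-right≤ s t =
  ≤-by (gap-≤ (i≤i⊔j (fst t + snd t) (fst s))) (identity ((fst t + snd t) ⊔ fst s) (fst t) (snd t))
  where identity : ∀ M x y → (M - y) - x ≡ M - (x + y)
        identity = solve-∀

sum-left≤ : ∀ s t → fst s + snd s ≤ mulFst s t + mulSnd s t
sum-left≤ s t =
  ≤-by (gap-≤ (i≤j⊔i (fst t + snd t) (fst s)))
       (identity ((fst t + snd t) ⊔ fst s) (fst s) (snd s) (snd t))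
  where identity : ∀ M x y z → ((M - z) + (y + z)) - (x + y) ≡ M - x
        identity = solve-∀

factor-bounds : ∀ u s t → u ≐ s · t → fst t ≤ fst u × fst s + snd s ≤ fst u + snd u
factor-bounds u s t (fst≡ , snd≡) =
  subst (fst t ≤_) (sym fst≡) (fst-right≤ s t) ,
  subst (fst s + snd s ≤_) (sym (cong₂ _+_ fst≡ snd≡)) (sum-left≤ s t)

absorbs-right : ∀ x e → snd e ≡ + 0 → fst e ≤ fst x → x ≐ x · e
absorbs-right x e@(⟨ c , _ ∣ _ , _ ⟩) refl c≤x =
  sym (trans (mulFst-left x e (subst (_≤ fst x) (sym (+-identityʳ c)) c≤x))
             (+-identityʳ (fst x))) ,
  sym (+-identityʳ (snd x))

absorbs-left : ∀ x e → snd e ≡ + 0 → fst e ≤ fst x + snd x → x ≐ e · x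
absorbs-left x e@(⟨ _ , _ ∣ _ , _ ⟩) refl e≤x =
  sym (mulFst-right e x e≤x) , sym (+-identityˡ (snd x))

_within_ : ℤ → ℕ → Set
z within m = NonNeg (z + + m) × NonNeg (+ m - z)

within-diff : ∀ {m j k} → j within m → k within m → (j - k) within (m ℕ.+ m)
within-diff {m} {j} {k} (j+m≥0 , m-j≥0) (k+m≥0 , m-k≥0) =
  subst NonNeg (sym (lower j k (+ m))) (nonNeg-+ j+m≥0 m-k≥0) ,
  subst NonNeg (sym (upper j k (+ m))) (nonNeg-+ m-j≥0 k+m≥0)
  where
  lower : ∀ j k m → (j - k) + (m + m) ≡ (j + m) + (m - k)
  lower = solve-∀
  upper : ∀ j k m → (m + m) - (j - k) ≡ (m - j) + (k + m)
  upper = solve-∀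

module BoundedSearch {P : ℤ → Set} (P? : Decidable P) (m : ℕ) where

  position : ℕ → ℤ
  position k = + k - + m

  position-within : ∀ {k} → k ℕ.< suc (m ℕ.+ m) → position k within m
  position-within {k} k≤2m =
    subst NonNeg (sym (shift (+ k) (+ m))) (nonNeg-ℕ k) ,
    subst NonNeg (sym (reflect (+ k) (+ m))) (gap-≤ (+≤+ (ℕₚ.≤-pred k≤2m)))
    where
    shift : ∀ k m → (k - m) + m ≡ k
    shift = solve-∀
    reflect : ∀ k m → m - (k - m) ≡ (m + m) - k
    reflect = solve-∀

  position-onto : ∀ {z} → z within m → ∃ λ k → k ℕ.< suc (m ℕ.+ m) × position k ≡ z
  position-onto {z} (z+m≥0 , m-z≥0) =
    ∣ z + + m ∣ , s≤s k≤2m , trans (cong (_- + m) k≡) (shift z (+ m))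
    where
    k≡ : + ∣ z + + m ∣ ≡ z + + m
    k≡ = 0≤i⇒+∣i∣≡i z+m≥0
    reflect : ∀ z m → (m + m) - (z + m) ≡ m - z
    reflect = solve-∀
    shift : ∀ z m → (z + m) - m ≡ z
    shift = solve-∀
    k≤2m : ∣ z + + m ∣ ℕ.≤ m ℕ.+ m
    k≤2m = drop‿+≤+ (≤-by m-z≥0 (trans (cong (λ w → (+ m + + m) - w) k≡) (reflect z (+ m))))

  any-within? : Dec (∃ λ z → z within m × P z)
  any-within? = map′ from to (anyUpTo? (P? ∘ position) (suc (m ℕ.+ m)))
    where
    from : (∃ λ k → k ℕ.< suc (m ℕ.+ m) × P (position k)) → ∃ λ z → z within m × P z
    from (k , k≤2m , Pk) = position k , position-within k≤2m , Pk
    to : (∃ λ z → z within m × P z) → ∃ λ k → k ℕ.< suc (m ℕ.+ m) × P (position k)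
    to (z , z∈ , Pz) with position-onto {z} z∈
    ... | k , k≤2m , refl = k , k≤2m , Pz

  all-within? : Dec (∀ z → z within m → P z)
  all-within? = map′ from to (allUpTo? (P? ∘ position) (suc (m ℕ.+ m)))
    where
    from : (∀ {k} → k ℕ.< suc (m ℕ.+ m) → P (position k)) → ∀ z → z within m → P z
    from all z z∈ with position-onto {z} z∈
    ... | k , k≤2m , refl = all k≤2m
    to : (∀ z → z within m → P z) → ∀ {k} → k ℕ.< suc (m ℕ.+ m) → P (position k)
    to all k≤2m = all _ (position-within k≤2m)

-- For a ≥ 2 the triple {(a,0), (0,0), (0,1)} is avoidable: colour an element by the sign of
-- its second coordinate, and on the row snd = 0 by whether it is (a,0).
module Triple (a : ℤ) (2≤a : + 2 ≤ a) where

  Point : ℤ → ℤ → Set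
  Point c e = (c ≡ a × e ≡ + 0) ⊎ (c ≡ + 0 × e ≡ + 0) ⊎ (c ≡ + 0 × e ≡ + 1)

  triple : Subset
  triple x = Point (fst x) (snd x)

  tone : ℤ → ℤ → Bool
  tone c (+ zero)  = does (c ≟ a)
  tone c (+ suc _) = true
  tone c -[1+ _ ]  = false

  colour : 𝓑 → Bool
  colour x = tone (fst x) (snd x)

  tone-true : ∀ c → does (c ≟ a) ≡ true → c ≡ a
  tone-true c eq with c ≟ a
  tone-true c eq | yes c≡a = c≡a
  tone-true c () | no _

  same-tone : ∀ {c c′} → does (c ≟ a) ≡ does (c′ ≟ a) → c ≡ a → c′ ≡ a
  same-tone {c} {c′} same c≡a = tone-true c′ (trans (sym same) (dec-true (c ≟ a) c≡a))

  a≰1 : ¬ (a ≤ + 1)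
  a≰1 a≤1 with ≤-trans 2≤a a≤1
  ... | +≤+ (s≤s ())

  negative-snd : ∀ {c m} → ¬ Point c -[1+ m ]
  negative-snd (inj₁ (_ , ()))
  negative-snd (inj₂ (inj₁ (_ , ())))
  negative-snd (inj₂ (inj₂ (_ , ())))

  -- Case analysis on the signs of the second coordinates: opposite signs have opposite
  -- colours, negative ones give a negative product, and the remaining cases are ruled out by
  -- the product bounds.
  excluded : ∀ s t → ¬ s ≈ t → colour s ≡ colour t → ¬ Point (mulFst s t) (mulSnd s t)
  excluded s@(⟨ fs , + zero ∣ _ , _ ⟩) t@(⟨ ft , + zero ∣ _ , _ ⟩) s≉t same (inj₁ (fst≡a , _)) =
    s≉t (trans (proj₁ both) (sym (proj₂ both)) , refl)
    where
    one : fs ≡ a ⊎ ft ≡ a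
    one with ≤-total (ft + + 0) fs
    ... | inj₁ t≤s = inj₁ (trans (sym (+-identityʳ fs)) (trans (sym (mulFst-left s t t≤s)) fst≡a))
    ... | inj₂ s≤t = inj₂ (trans (sym (mulFst-right s t s≤t)) fst≡a)
    both : fs ≡ a × ft ≡ a
    both with one
    ... | inj₁ fs≡a = fs≡a , same-tone same fs≡a
    ... | inj₂ ft≡a = same-tone (sym same) ft≡a , ft≡a
  excluded s@(⟨ fs , + zero ∣ fs≥0 , _ ⟩) t@(⟨ ft , + zero ∣ ft≥0 , _ ⟩) s≉t _
           (inj₂ (inj₁ (fst≡0 , _))) =
    s≉t (trans fs≡0 (sym ft≡0) , refl)
    where
    ft≡0 : ft ≡ + 0
    ft≡0 = ≤-antisym (subst (ft ≤_) fst≡0 (fst-right≤ s t)) ft≥0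
    fs≡0 : fs ≡ + 0
    fs≡0 = ≤-antisym (subst₂ _≤_ (+-identityʳ fs) (cong (_+ + 0) fst≡0) (sum-left≤ s t)) fs≥0
  excluded ⟨ _ , + zero ∣ _ , _ ⟩ ⟨ _ , + zero ∣ _ , _ ⟩ _ _ (inj₂ (inj₂ (_ , ())))
  excluded ⟨ _ , + zero ∣ _ , _ ⟩ ⟨ _ , + suc _ ∣ _ , _ ⟩ _ _ (inj₁ (_ , ()))
  excluded ⟨ _ , + zero ∣ _ , _ ⟩ ⟨ _ , + suc _ ∣ _ , _ ⟩ _ _ (inj₂ (inj₁ (_ , ())))
  excluded s@(⟨ fs , + zero ∣ _ , _ ⟩) t@(⟨ _ , + suc _ ∣ _ , _ ⟩) _ same
           (inj₂ (inj₂ (fst≡0 , snd≡1))) =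
    a≰1 (subst₂ _≤_ (trans (+-identityʳ fs) (tone-true fs same)) (cong₂ _+_ fst≡0 snd≡1)
                    (sum-left≤ s t))
  excluded ⟨ _ , + suc _ ∣ _ , _ ⟩ ⟨ _ , + zero ∣ _ , _ ⟩ _ _ (inj₁ (_ , ()))
  excluded ⟨ _ , + suc _ ∣ _ , _ ⟩ ⟨ _ , + zero ∣ _ , _ ⟩ _ _ (inj₂ (inj₁ (_ , ())))
  excluded s@(⟨ _ , + suc _ ∣ _ , _ ⟩) t@(⟨ ft , + zero ∣ _ , _ ⟩) _ same
           (inj₂ (inj₂ (fst≡0 , _))) =
    a≰1 (≤-trans (subst₂ _≤_ (tone-true ft (sym same)) fst≡0 (fst-right≤ s t)) (+≤+ z≤n))
  excluded ⟨ _ , + suc _ ∣ _ , _ ⟩ ⟨ _ , + suc _ ∣ _ , _ ⟩ _ _ (inj₁ (_ , ()))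
  excluded ⟨ _ , + suc _ ∣ _ , _ ⟩ ⟨ _ , + suc _ ∣ _ , _ ⟩ _ _ (inj₂ (inj₁ (_ , ())))
  excluded ⟨ _ , + suc m ∣ _ , _ ⟩ ⟨ _ , + suc _ ∣ _ , _ ⟩ _ _ (inj₂ (inj₂ (_ , snd≡1))) =
    ℕₚ.m+1+n≢0 m (ℕₚ.suc-injective (+-injective snd≡1))
  excluded ⟨ _ , + suc _ ∣ _ , _ ⟩ ⟨ _ , -[1+ _ ] ∣ _ , _ ⟩ _ () _
  excluded ⟨ _ , -[1+ _ ] ∣ _ , _ ⟩ ⟨ _ , + suc _ ∣ _ , _ ⟩ _ () _
  excluded ⟨ _ , + zero ∣ _ , _ ⟩ ⟨ _ , -[1+ _ ] ∣ _ , _ ⟩ _ _ p = negative-snd p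
  excluded ⟨ _ , -[1+ _ ] ∣ _ , _ ⟩ ⟨ _ , + zero ∣ _ , _ ⟩ _ _ p = negative-snd p
  excluded ⟨ _ , -[1+ _ ] ∣ _ , _ ⟩ ⟨ _ , -[1+ _ ] ∣ _ , _ ⟩ _ _ p = negative-snd p

  avoidable : Avoidable triple
  avoidable = colour , λ s t s≉t same u u∈ prod →
    excluded s t s≉t same (subst₂ Point (proj₁ prod) (proj₂ prod) u∈)

module Colouring (U : Subset) (χ : 𝓑 → Bool) (avoids : Avoids χ U)
                 (n : ℕ) (1≤n : 1 ℕ.≤ n) (A∈U : ∀ x → x is⟨ + n , + 0 ⟩ → U x) where

  a : ℤ
  a = + n

  0≤a : NonNeg a
  0≤a = nonNeg-ℕ n

  0<a : + 0 < a
  0<a = +<+ 1≤n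

  A O : 𝓑
  A = ⟨ a , + 0 ∣ 0≤a , nonNeg-ℕ _ ⟩
  O = ⟨ + 0 , + 0 ∣ nonNeg-ℕ 0 , nonNeg-ℕ 0 ⟩

  factors-differ : ∀ u s t → U u → u ≐ s · t → ¬ s ≈ t → χ s ≢ χ t
  factors-differ u s t Uu prod s≉t same = avoids s t s≉t same u Uu prod

  A-factors-differ : ∀ s t → mulFst s t ≡ a → mulSnd s t ≡ + 0 → ¬ s ≈ t → χ s ≢ χ t
  A-factors-differ s t fst≡a snd≡0 =
    factors-differ A s t (A∈U A (refl , refl)) (sym fst≡a , sym snd≡0)

  Small : 𝓑 → Set
  Small x = fst x < a ⊎ fst x + snd x < a

  -- The partner of row h: a fixed element that multiplies with every small element of row h
  -- (on the appropriate side) to A.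
  partner : ℤ → 𝓑
  partner (+ zero)  = A
  partner (+ suc m) =
    ⟨ a + + suc m , -[1+ m ] ∣ nonNeg-ℕ _ , subst NonNeg (sym (cancel a (+ suc m))) 0≤a ⟩
    where cancel : ∀ a h → (a + h) + - h ≡ a
          cancel = solve-∀
  partner -[1+ m ]  = ⟨ a , + suc m ∣ 0≤a , nonNeg-ℕ _ ⟩

  -- row 0: x·A = A; row h > 0: partner·x = A; row h < 0: x·partner = A
  partner-differs : ∀ x → Small x → χ x ≢ χ (partner (snd x))
  partner-differs x@(⟨ q , + zero ∣ _ , _ ⟩) small =
    A-factors-differ x A (mulFst-right x A (subst (q ≤_) (sym (+-identityʳ a)) (<⇒≤ q<a))) refl
      (λ (q≡a , _) → <⇒≢ q<a q≡a)
    where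
    q<a : q < a
    q<a = [ id , subst (_< a) (+-identityʳ q) ]′ small
  partner-differs x@(⟨ q , + suc m ∣ _ , _ ⟩) small =
    ≢-sym (A-factors-differ (partner (+ suc m)) x
      (trans (mulFst-left (partner (+ suc m)) x (+-monoˡ-≤ (+ suc m) q≤a)) (cancel a (+ suc m)))
      (+-inverseˡ (+ suc m)) (λ { (_ , ()) }))
    where
    cancel : ∀ a h → (a + h) - h ≡ a
    cancel = solve-∀
    growth : ∀ q h → (q + h) - q ≡ h
    growth = solve-∀
    q≤a : q ≤ a
    q≤a = [ <⇒≤
          , (λ q+h<a → <⇒≤ (≤-<-trans (≤-by (nonNeg-ℕ (suc m)) (growth q (+ suc m))) q+h<a))
          ]′ small
  partner-differs x@(⟨ q , -[1+ m ] ∣ _ , _ ⟩) small =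
    A-factors-differ x (partner -[1+ m ]) (mulFst-right x (partner -[1+ m ]) q≤)
      (+-inverseˡ (+ suc m)) (λ { (_ , ()) })
    where
    shift : ∀ a q h → (a + h) - q ≡ a - (q + - h)
    shift = solve-∀
    drop : ∀ q h → q - (q + - h) ≡ h
    drop = solve-∀
    sum≤a : q + -[1+ m ] ≤ a
    sum≤a = [ (λ q<a → <⇒≤ (≤-<-trans (≤-by (nonNeg-ℕ (suc m)) (drop q (+ suc m))) q<a))
            , <⇒≤
            ]′ small
    q≤ : q ≤ a + + suc m
    q≤ = ≤-by (gap-≤ sum≤a) (shift a q (+ suc m))

  col : ℤ → Bool
  col h = not (χ (partner h))

  colour-by-row : ∀ x → Small x → χ x ≡ col (snd x)
  colour-by-row x small = ¬-not (partner-differs x small)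

  -- Opposite rows have opposite colours, since their partners multiply to A.
  opposite-rows : ∀ h → h ≢ + 0 → col h ≢ col (- h)
  opposite-rows (+ zero)  h≢0 = ⊥-elim (h≢0 refl)
  opposite-rows (+ suc m) _   = partners-differ ∘ not-injective
    where
    partners-differ : χ (partner (+ suc m)) ≢ χ (partner -[1+ m ])
    partners-differ =
      A-factors-differ _ _ (mulFst-right (partner (+ suc m)) (partner -[1+ m ]) ≤-refl)
        (+-inverseˡ (+ suc m)) (λ { (_ , ()) })
  opposite-rows -[1+ m ]  _   = ≢-sym (opposite-rows (+ suc m) (λ ()))

  Box : 𝓑 → Set
  Box x = fst x < a × fst x + snd x < a

  -- A box element w = (c, p + q) of U factors as (c+q, p)·(c, q) when c + q ≥ 0; both
  -- factors are small, so col p ≠ col q unless p = q = 0.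
  split-colours′ : ∀ w → U w → Box w → ∀ p q → p + q ≡ snd w → ¬ (p ≡ + 0 × q ≡ + 0) →
                   NonNeg (fst w + q) → col p ≢ col q
  split-colours′ w@(⟨ c , .(p + q) ∣ c≥0 , c+e≥0 ⟩) Uw (c<a , c+e<a) p q refl nonzero c+q≥0 same =
    factors-differ w s t Uw (sym (mulFst-right s t ≤-refl) , refl) s≉t
      (trans (colour-by-row s (inj₂ (subst (_< a) (reassoc c p q) c+e<a)))
             (trans same (sym (colour-by-row t (inj₁ c<a)))))
    where
    reassoc : ∀ c p q → c + (p + q) ≡ c + q + p
    reassoc = solve-∀
    s t : 𝓑
    s = ⟨ c + q , p ∣ c+q≥0 , subst NonNeg (reassoc c p q) c+e≥0 ⟩
    t = ⟨ c , q ∣ c≥0 , c+q≥0 ⟩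
    cancel : ∀ c q → q ≡ (c + q) - c
    cancel = solve-∀
    s≉t : ¬ s ≈ t
    s≉t (c+q≡c , p≡q) = nonzero (trans p≡q q≡0 , q≡0)
      where q≡0 = trans (cancel c q) (trans (cong (_- c) c+q≡c) (+-inverseʳ c))

  -- In general: if c + q < 0 then c + p ≥ 0, and the roles of p and q are exchanged.
  split-colours : ∀ w → U w → Box w → ∀ p q → p + q ≡ snd w → ¬ (p ≡ + 0 × q ≡ + 0) →
                  col p ≢ col q
  split-colours w Uw box p q p+q≡e nonzero with + 0 ≤? fst w + q
  ... | yes c+q≥0 = split-colours′ w Uw box p q p+q≡e nonzero c+q≥0
  ... | no  c+q≱0 = ≢-sym (split-colours′ w Uw box q p (trans (+-comm q p) p+q≡e)
                                          (λ (q≡0 , p≡0) → nonzero (p≡0 , q≡0)) c+p≥0)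
    where
    certificate : ∀ c p q → (c + p) - + 0 ≡ (c + (p + q)) + (+ 0 - (c + q) - + 1) + c + + 1
    certificate = solve-∀
    c+e≥0 : NonNeg (fst w + (p + q))
    c+e≥0 = subst (λ e → NonNeg (fst w + e)) (sym p+q≡e) (sum≥0 w)
    c+p≥0 : NonNeg (fst w + p)
    c+p≥0 = ≤-by (nonNeg-+ (nonNeg-+ (nonNeg-+ c+e≥0 (gap-< (≰⇒> c+q≱0))) (fst≥0 w)) (nonNeg-ℕ 1))
                 (certificate (fst w) p q)

  -- Every element of U other than O has the colour of A, because O·x = x and O·A = A.
  coloured-like-A : ∀ x → U x → ¬ x ≈ O → χ x ≡ χ A
  coloured-like-A x Ux x≉O =
    both-differ (≢-sym (factors-differ x O x Ux (absorbs-left x O refl (sum≥0 x))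
                                       (λ (e₁ , e₂) → x≉O (sym e₁ , sym e₂))))
                (≢-sym (factors-differ A O A (A∈U A (refl , refl)) (absorbs-left A O refl (nonNeg-ℕ _))
                                       (λ (0≡a , _) → <⇒≢ 0<a 0≡a)))

  OddBox : 𝓑 → Set
  OddBox x = Box x × OddInt (snd x)

  classify : ∀ x → U x → x is⟨ a , + 0 ⟩ ⊎ x is⟨ + 0 , + 0 ⟩ ⊎ OddBox x
  classify x Ux with fst x ≟ + 0 ×-dec snd x ≟ + 0 | fst x ≟ a ×-dec snd x ≟ + 0
  ... | yes x≈O | _       = inj₂ (inj₁ x≈O)
  ... | no _    | yes x≈A = inj₁ x≈A
  ... | no x≉O  | no x≉A  = inj₂ (inj₂ (box , odd-row))
    where
    like-A : χ x ≡ χ A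
    like-A = coloured-like-A x Ux x≉O
    -- x = x·A if a ≤ fst x, and x = A·x if a ≤ fst x + snd x
    box : Box x
    box = ≰⇒> (λ a≤c → factors-differ x x A Ux (absorbs-right x A refl a≤c) x≉A like-A) ,
          ≰⇒> (λ a≤c+e → factors-differ x A x Ux (absorbs-left x A refl a≤c+e)
                                         (λ (e₁ , e₂) → x≉A (sym e₁ , sym e₂)) (sym like-A))
    -- an even row 2k is excluded: by A = x·A for k = 0, and by splitting 2k = k + k otherwise
    odd-row : OddInt (snd x)
    odd-row with even-or-odd (snd x)
    ... | inj₂ odd = odd
    ... | inj₁ (k , e≡k+k) with k ≟ + 0
    ...   | yes refl = ⊥-elim (partner-differs x (inj₁ (proj₁ box))
                                                 (trans like-A (cong (χ ∘ partner) (sym e≡k+k))))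
    ...   | no k≢0   = ⊥-elim (split-colours x Ux box k k (sym e≡k+k) (k≢0 ∘ proj₁) refl)

  odd : ℤ → ℤ
  odd k = + 2 * k + + 1

  index-bound : ∀ x → Box x → ∀ k → snd x ≡ odd k → k within n
  index-bound ⟨ c , .(odd k) ∣ c≥0 , c+e≥0 ⟩ (c<a , c+e<a) k refl =
    halve (subst NonNeg (sym (lower c k a)) (nonNeg-+ (nonNeg-+ c+e≥0 (gap-< c<a)) 0≤a)) ,
    halve (subst NonNeg (sym (upper c k a))
                 (nonNeg-+ (nonNeg-+ (nonNeg-+ (gap-< c+e<a) c≥0) 0≤a) (nonNeg-ℕ 2)))
    where
    lower : ∀ c k a → (k + a) + (k + a) ≡ ((c + (+ 2 * k + + 1)) + (a - c - + 1)) + a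
    lower = solve-∀
    upper : ∀ c k a → (a - k) + (a - k) ≡ (((a - (c + (+ 2 * k + + 1)) - + 1) + c) + a) + + 2
    upper = solve-∀

  Candidate : ℤ → Set
  Candidate j = odd j < a × (∀ q → q within (n ℕ.+ n) → col q ≢ col (odd j - q))

  candidate? : Decidable Candidate
  candidate? j = odd j <? a ×-dec
                 BoundedSearch.all-within? (λ q → ¬? (col q ≟ᵇ col (odd j - q))) (n ℕ.+ n)

  -- An odd box element of U in row odd k makes k a candidate, by splitting
  -- odd k = q + (odd k - q).
  oddBox-candidate : ∀ x → U x → Box x → ∀ k → snd x ≡ odd k → Candidate k
  oddBox-candidate x Ux box@(_ , c+e<a) k e≡ =
    subst (_< a) e≡ (≤-<-trans (≤-by (fst≥0 x) (cancel (fst x) (snd x))) c+e<a) ,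
    λ q _ → split-colours x Ux box q (odd k - q) (trans (split q (odd k)) (sym e≡))
              (λ (q≡0 , r≡0) → odd≢0 (k , refl)
                                   (trans (sym (split q (odd k))) (cong₂ _+_ q≡0 r≡0)))
    where
    cancel : ∀ c e → (c + e) - e ≡ c
    cancel = solve-∀
    split : ∀ q d → q + (d - q) ≡ d
    split = solve-∀

  Row : ℤ → Set
  Row d = ∀ x → U x → OddBox x → snd x ≡ d

  -- A candidate j determines the row: for an odd box element of U in row odd k with k ≠ j,
  -- the colours of h = k - j, -h and M = k + j + 1 would be pairwise distinct, as
  -- h + M = odd k, -h + M = odd j and h ≠ 0.
  candidate-row : ∀ j → j within n → Candidate j → Row (odd j)
  candidate-row j j∈ (_ , separates) x Ux (box , k , e≡) with k ≟ j
  ... | yes refl = e≡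
  ... | no k≢j   = ⊥-elim (no-three-colours col-h≢col-M (≢-sym col-−h≢col-M) (opposite-rows h h≢0))
    where
    h M : ℤ
    h = k - j
    M = k + j + + 1
    h≢0 : h ≢ + 0
    h≢0 h≡0 = k≢j (i-j≡0⇒i≡j k j h≡0)
    split-k : ∀ k j → (k - j) + (k + j + + 1) ≡ + 2 * k + + 1
    split-k = solve-∀
    split-j : ∀ k j → (+ 2 * j + + 1) - (- (k - j)) ≡ k + j + + 1
    split-j = solve-∀
    flip : ∀ k j → j - k ≡ - (k - j)
    flip = solve-∀
    col-h≢col-M : col h ≢ col M
    col-h≢col-M = split-colours x Ux box h M (trans (split-k k j) (sym e≡)) (h≢0 ∘ proj₁)
    col-−h≢col-M : col (- h) ≢ col M
    col-−h≢col-M = subst (λ r → col (- h) ≢ col r) (split-j k j)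
      (separates (- h) (subst (_within (n ℕ.+ n)) (flip k j)
                              (within-diff {n} {j} {k} j∈ (index-bound x box k e≡))))

  -- Some odd d < a carries all odd box elements of U: a candidate if the finite search finds
  -- one, and otherwise any odd d < a, since then U has no odd box elements at all.
  choose-row : Σ ℤ λ d → OddInt d × d < a × Row d
  choose-row with BoundedSearch.any-within? candidate? n
  ... | yes (j , j∈ , cand) = odd j , (j , refl) , proj₁ cand , candidate-row j j∈ cand
  ... | no  none = odd -[1+ 0 ] , (-[1+ 0 ] , refl) , -<+ , no-row
    where
    no-row : Row (odd -[1+ 0 ])
    no-row x Ux (box , k , e≡) =
      ⊥-elim (none (k , index-bound x box k e≡ , oddBox-candidate x Ux box k e≡))

module Characterisation (U : Subset) (χ : 𝓑 → Bool) (avoids : Avoids χ U)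
                        (maximal : ∀ (V : Subset) → U ⊆ V → Avoidable V → V ⊆ U)
                        (n : ℕ) (1≤n : 1 ℕ.≤ n) (A∈U : ∀ x → x is⟨ + n , + 0 ⟩ → U x) where

  open Colouring U χ avoids n 1≤n A∈U public

  -- For a = 1 the box is {O}, so an odd box element forces a ≥ 2.
  oddBox⇒2≤a : ∀ x → OddBox x → + 2 ≤ a
  oddBox⇒2≤a x ((c<a , c+e<a) , e-odd) with + 2 ≤? a
  ... | yes 2≤a = 2≤a
  ... | no  2≰a = ⊥-elim (odd≢0 e-odd (trans (cancel (fst x) (snd x)) (cong₂ _-_ c+e≡0 c≡0)))
    where
    a<2 = ≰⇒> 2≰a
    squeeze : ∀ a c → + 0 - c ≡ (a - c - + 1) + (+ 2 - a - + 1)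
    squeeze = solve-∀
    cancel : ∀ c e → e ≡ (c + e) - c
    cancel = solve-∀
    c≡0 : fst x ≡ + 0
    c≡0 = ≤-antisym (≤-by (nonNeg-+ (gap-< c<a) (gap-< a<2)) (squeeze a (fst x))) (fst≥0 x)
    c+e≡0 : fst x + snd x ≡ + 0
    c+e≡0 = ≤-antisym (≤-by (nonNeg-+ (gap-< c+e<a) (gap-< a<2)) (squeeze a (fst x + snd x))) (sum≥0 x)

  -- U has an odd box element, in the double negated sense: otherwise U lies in the avoidable
  -- triple {A, O, (0,1)}, so by maximality (0,1) ∈ U, and (0,1) is an odd box element.
  oddBox-exists : + 2 ≤ a → ¬ ¬ (Σ 𝓑 λ x → U x × OddBox x)
  oddBox-exists 2≤a none =
    none (E , maximal triple U⊆triple avoidable E (inj₂ (inj₂ (refl , refl))) , E-oddBox)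
    where
    open Triple a 2≤a using (triple; avoidable)
    E : 𝓑
    E = ⟨ + 0 , + 1 ∣ nonNeg-ℕ 0 , nonNeg-ℕ 1 ⟩
    E-oddBox : OddBox E
    E-oddBox = (0<a , suc[i]≤j⇒i<j 2≤a) , (+ 0 , refl)
    U⊆triple : U ⊆ triple
    U⊆triple x Ux with classify x Ux
    ... | inj₁ x≈A            = inj₁ x≈A
    ... | inj₂ (inj₁ x≈O)     = inj₂ (inj₁ x≈O)
    ... | inj₂ (inj₂ odd-box) = ⊥-elim (none (x , Ux , odd-box))

  row-separates : ∀ {d} → OddInt d → + 2 ≤ a → Row d → ∀ p q → p + q ≡ d → col p ≢ col q
  row-separates d-odd 2≤a row p q p+q≡d same = oddBox-exists 2≤a λ (x , Ux , x-oddBox) →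
    split-colours x Ux (proj₁ x-oddBox) p q (trans p+q≡d (sym (row x Ux x-oddBox)))
      (λ (p≡0 , q≡0) → odd≢0 d-odd (trans (sym p+q≡d) (cong₂ _+_ p≡0 q≡0))) same

  O-factor-bounds : ∀ s t → O ≐ s · t → fst t ≤ + 0 × fst s + snd s ≤ + 0 × snd s ≡ - snd t
  O-factor-bounds s t prod =
    proj₁ (factor-bounds O s t prod) , proj₂ (factor-bounds O s t prod) ,
    trans (cancel (snd s) (snd t)) (trans (cong (_- snd t) (sym (proj₂ prod))) (+-identityˡ (- snd t)))
    where cancel : ∀ x y → x ≡ (x + y) - y
          cancel = solve-∀

  -- Distinct equally coloured elements never multiply to O: both factors are small and lie
  -- in opposite rows, so either both are O or their colours are opposite.
  O-factors-differ : ∀ s t → O ≐ s · t → ¬ s ≈ t → χ s ≢ χ t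
  O-factors-differ s t prod s≉t same with O-factor-bounds s t prod | snd t ≟ + 0
  ... | t≤0 , s≤0 , es≡−et | yes et≡0 = s≉t (trans fs≡0 (sym ft≡0) , trans es≡0 (sym et≡0))
    where
    es≡0 : snd s ≡ + 0
    es≡0 = trans es≡−et (cong -_ et≡0)
    ft≡0 : fst t ≡ + 0
    ft≡0 = ≤-antisym t≤0 (fst≥0 t)
    fs≡0 : fst s ≡ + 0
    fs≡0 = ≤-antisym (subst (_≤ + 0) (trans (cong (λ e → fst s + e) es≡0) (+-identityʳ (fst s))) s≤0)
                     (fst≥0 s)
  ... | t≤0 , s≤0 , es≡−et | no et≢0  = opposite-rows (snd t) et≢0 (begin
    col (snd t)    ≡⟨ sym (colour-by-row t (inj₁ (≤-<-trans t≤0 0<a))) ⟩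
    χ t            ≡⟨ sym same ⟩
    χ s            ≡⟨ colour-by-row s (inj₂ (≤-<-trans s≤0 0<a)) ⟩
    col (snd s)    ≡⟨ cong col es≡−et ⟩
    col (- snd t)  ∎)
    where open ≡-Reasoning

  S : ℤ → Subset
  S d x = x is⟨ a , + 0 ⟩ ⊎ x is⟨ + 0 , + 0 ⟩ ⊎ (snd x ≡ d × (fst x ⊔ (fst x + snd x)) < a)

  box⇒max< : ∀ x → Box x → (fst x ⊔ (fst x + snd x)) < a
  box⇒max< x (c<a , c+e<a) with ⊔-sel (fst x) (fst x + snd x)
  ... | inj₁ max≡c   = subst (_< a) (sym max≡c) c<a
  ... | inj₂ max≡c+e = subst (_< a) (sym max≡c+e) c+e<a

  max<⇒box : ∀ x → (fst x ⊔ (fst x + snd x)) < a → Box x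
  max<⇒box x max<a = ≤-<-trans (i≤i⊔j (fst x) _) max<a , ≤-<-trans (i≤j⊔i (fst x) _) max<a

  -- χ avoids S d: products landing on A are excluded because A ∈ U, products landing on O
  -- by O-factors-differ, and products landing in row d have small factors whose rows split d.
  S-avoided : ∀ d → OddInt d → Row d → Avoids χ (S d)
  S-avoided _ _ _ s t s≉t same u (inj₁ u≈A) prod = avoids s t s≉t same u (A∈U u u≈A) prod
  S-avoided _ _ _ s t s≉t same u (inj₂ (inj₁ (c≡0 , e≡0))) (c≡ , e≡) =
    O-factors-differ s t (trans (sym c≡0) c≡ , trans (sym e≡0) e≡) s≉t same
  S-avoided _ d-odd row s t s≉t same u (inj₂ (inj₂ (e≡d , max<a))) prod =
    row-separates d-odd (oddBox⇒2≤a u (u-box , subst OddInt (sym e≡d) d-odd)) row (snd s) (snd t)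
      (trans (sym (proj₂ prod)) e≡d)
      (trans (sym (colour-by-row s (inj₂ (≤-<-trans s≤u (proj₂ u-box)))))
             (trans same (colour-by-row t (inj₁ (≤-<-trans t≤u (proj₁ u-box))))))
    where
    u-box = max<⇒box u max<a
    t≤u = proj₁ (factor-bounds u s t prod)
    s≤u = proj₂ (factor-bounds u s t prod)

  characterise : ∀ d → OddInt d → Row d → ∀ x → U x ⇔ S d x
  characterise d d-odd row x = mk⇔ (U⊆S x) (maximal (S d) U⊆S (χ , S-avoided d d-odd row) x)
    where
    U⊆S : U ⊆ S d
    U⊆S y Uy with classify y Uy
    ... | inj₁ y≈A            = inj₁ y≈A
    ... | inj₂ (inj₁ y≈O)     = inj₂ (inj₁ y≈O)
    ... | inj₂ (inj₂ y-odd)   = inj₂ (inj₂ (row y Uy y-odd , box⇒max< y (proj₁ y-odd)))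

mainTheorem16 : (U : Subset) → MaximalAvoidable U →
    (a : ℤ) → + 1 ≤ a → (∀ x → x is⟨ a , + 0 ⟩ → U x) →
    Σ ℤ λ d → OddInt d × d < a ×
    (∀ (x : 𝓑) → U x ⇔ (x is⟨ a , + 0 ⟩ ⊎ x is⟨ + 0 , + 0 ⟩ ⊎ (snd x ≡ d × (fst x ⊔ (fst x + snd x)) < a)))
mainTheorem16 U ((χ , avoids) , maximal) .(+ n) (+≤+ {n = n} 1≤n) A∈U =
  let open Characterisation U χ avoids maximal n 1≤n A∈U
      (d , d-odd , d<a , row) = choose-row
  in  d , d-odd , d<a , characterise d d-odd row
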